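{- Let $k\ge 1$ and $n\ge 2$ be integers. The following are equivalent: (1) there exist $k$ mutually orthogonal Latin squares of order $n$; (2) $\mathsf{id}_{k+2}\le \mathsf{PHP}^{n^2}_{n}$. In particular, $\mathsf{id}_3\le\mathsf{PHP}^{n^2}_{n}$, and hence $\mathsf{PHP}^{n^2}_{n}<\mathsf{PHP}^{n^2+1}_{n}$ (i.e. $\mathsf{PHP}^{n^2+1}_{n}\le \mathsf{PHP}^{n^2}_{n}$ but $\mathsf{PHP}^{n^2}_{n}\not\le \mathsf{PHP}^{n^2+1}_{n}$).
   Context: A number $N\ge1$ is identified with $\{0,\dots,N-1\}$. A (finite) problem $\mathsf{P}$ consists of a nonempty finite set of instances and, for each instance $x$, a nonempty finite set $\mathsf{P}(x)$ of solutions. For finite problems $\mathsf{P},\mathsf{Q}$, write $\mathsf{P}\le\mathsf{Q}$ if there exist a map $\Phi$ sending each $\mathsf{P}$-instance $x$ to a $\mathsf{Q}$-instance $\Phi(x)$ and a (partial) map $\Psi$ on $\mathsf{Q}$-solutions such that for every $\mathsf{P}$-instance $x$ and every $y\in\mathsf{Q}(\Phi(x))$, $\Psi(y)\in\mathsf{P}(x)$ (note $\Psi$ does not have access to $x$). Write $\mathsf{P}<\mathsf{Q}$ if $\mathsf{P}\le\mathsf{Q}$ and $\mathsf{Q}\not\le\mathsf{P}$. For integers $m>n\ge2$, the problem $\mathsf{PHP}^m_n$ has as instances all functions $f:m\to n$, and the solutions to $f$ are all unordered pairs $\{i,j\}\subseteq m$ with $i\ne j$ and $f(i)=f(j)$.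 For $k\ge1$, the problem $\mathsf{id}_k$ has instances $j\in\{1,\dots,k\}$, each instance $j$ having unique solution $j$. -}

module Defs where

open import Data.Nat using (ℕ; suc; _+_; _*_)
open import Data.Fin using (Fin; _<_)
open import Data.Product using (Σ; ∃; _×_; _,_)
open import Data.Maybe using (Maybe; just)
open import Relation.Binary.PropositionalEquality using (_≡_; _≢_)
open import Function.Definitions using (Bijective)

record Problem : Set₁ where
  field
    Inst  : Set
    Sol   : Set
    _solves_ : Sol → Inst → Set
open Problem public

_≤ᴾ_ : Problem → Problem → Set
P ≤ᴾ Q =
  Σ (Inst P → Inst Q) λ Φ →
  Σ (Sol Q → Maybe (Sol P)) λ Ψ →
    ∀ (x : Inst P) (y : Sol Q) → _solves_ Q y (Φ x) →
      ∃ λ s → (Ψ y ≡ just s) × _solves_ P s x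

-- PHP^m_n : instances f : m → n; solutions unordered pairs {i,j}, i ≠ j,
-- f i = f j, encoded canonically as ordered pairs (i , j) with i < j.
PHP : ℕ → ℕ → Problem
PHP m n = record
  { Inst = Fin m → Fin n
  ; Sol  = Fin m × Fin m
  ; _solves_ = λ { (i , j) f → (i < j) × (f i ≡ f j) }
  }

idP : ℕ → Problem
idP k = record
  { Inst = Fin k
  ; Sol  = Fin k
  ; _solves_ = λ s j → s ≡ j
  }

IsLatin : (n : ℕ) → (Fin n → Fin n → Fin n) → Set
IsLatin n L = (∀ i → Bijective _≡_ _≡_ (L i))
            × (∀ j → Bijective _≡_ _≡_ (λ i → L i j))

Orthogonal : (n : ℕ) → (Fin n → Fin n → Fin n) → (Fin n → Fin n → Fin n) → Set
Orthogonal n L M =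
  Bijective {A = Fin n × Fin n} {B = Fin n × Fin n} _≡_ _≡_
    (λ { (i , j) → (L i j , M i j) })

MOLS : ℕ → ℕ → Set
MOLS k n = Σ (Fin k → Fin n → Fin n → Fin n) λ L →
  (∀ a → IsLatin n (L a)) × (∀ a b → a ≢ b → Orthogonal n (L a) (L b))

{-# OPTIONS --safe #-}
module Submission where

-- A reduction of id_m to PHP^N_n is a family of m colourings of N pigeons with n colours,
-- any two of which separate points: Ψ must recover the colouring from a collision, so no
-- pair of pigeons may collide under two different colourings. For N = n², two colourings
-- that separate points biject the pigeons with the n × n grid; using them as row and column
-- coordinates, every further colouring is a Latin square and any two of them are orthogonal.
-- Strictness: id_3 ≤ PHP^{n²}_n ≤ PHP^{n²+1}_n would give two colourings separating n² + 1
-- points with only n² pairs of colours.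

open import Defs
open import Data.Fin as Fin using (Fin; zero; suc; toℕ; inject≤; punchOut; _≟_)
open import Data.Fin.Properties
  using (any?; <-cmp; <⇒≢; toℕ-inject≤; toℕ-injective; toℕ-fromℕ<; toℕ<n; suc-injective;
         punchOut-injective; injective⇒≤; *↔×)
open import Data.Maybe using (Maybe; just; nothing; _>>=_)
open import Data.Maybe.Properties using (just-injective)
open import Data.Nat as ℕ using (ℕ; _+_; _*_; _%_; _≤_; NonZero; pred)
import Data.Nat.Properties as ℕ
open import Data.Nat.DivMod using (_mod_; %-distribˡ-+; [m+kn]%n≡m%n; m<n⇒m%n≡m)
open import Data.Product using (∃; ∃-syntax; _×_; _,_; proj₁; proj₂; <_,_>; uncurry; swap)
open import Data.Product.Properties using (,-injective; ,-injectiveˡ; ,-injectiveʳ)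
open import Function using (_∘_; id; _⇔_; mk⇔; _↔_; Inverse; Injection; Equivalence)
open import Function.Definitions using (Injective; StrictlySurjective; Bijective)
open import Function.Consequences.Propositional using (strictlySurjective⇒surjective)
open import Function.Properties.Inverse using (↔-refl; ↔-sym; ↔⇒↣)
import Function.Properties.Equivalence as ⇔
open import Relation.Binary.Definitions using (tri<; tri≈; tri>)
open import Relation.Binary.PropositionalEquality
open import Relation.Nullary using (¬_; yes; no; contradiction)

private
  variable
    k m n N M : ℕ
    I P Q : Set

to-injective : (P↔Q : P ↔ Q) → Injective _≡_ _≡_ (Inverse.to P↔Q)
to-injective P↔Q = Injection.injective (↔⇒↣ P↔Q)

from-injective : (P↔Q : P ↔ Q) → Injective _≡_ _≡_ (Inverse.from P↔Q)
from-injective P↔Q = Injection.injective (↔⇒↣ (↔-sym P↔Q))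

injective⇒strictlySurjective : {f : Fin n → Fin n} → Injective _≡_ _≡_ f → StrictlySurjective _≡_ f
injective⇒strictlySurjective {ℕ.suc n} {f} f-inj y with any? (λ x → f x ≟ y)
... | yes hit  = hit
... | no  miss = contradiction (injective⇒≤ {f = avoidY} avoidY-inj) ℕ.1+n≰n
  where
  avoidY : Fin (ℕ.suc n) → Fin n
  avoidY x = punchOut {i = y} {j = f x} (λ y≡fx → miss (x , sym y≡fx))
  avoidY-inj : Injective _≡_ _≡_ avoidY
  avoidY-inj = f-inj ∘ punchOut-injective {i = y} _ _

module _ (P↔Fin : P ↔ Fin m) where
  open Inverse P↔Fin using (to; from)

  injective⇒strictlySurjectiveᶠ : {f : P → P} → Injective _≡_ _≡_ f → StrictlySurjective _≡_ f
  injective⇒strictlySurjectiveᶠ f-inj y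
    with x , to-fx≡to-y ← injective⇒strictlySurjective
                            (from-injective P↔Fin ∘ f-inj ∘ to-injective P↔Fin) (to y)
    = from x , to-injective P↔Fin to-fx≡to-y

  injective⇒bijectiveᶠ : {f : P → P} → Injective _≡_ _≡_ f → Bijective _≡_ _≡_ f
  injective⇒bijectiveᶠ f-inj =
    f-inj , strictlySurjective⇒surjective (injective⇒strictlySurjectiveᶠ f-inj)

≤ᴾ-trans : ∀ {A B C} → A ≤ᴾ B → B ≤ᴾ C → A ≤ᴾ C
≤ᴾ-trans {A} {B} {C} (Φ₁ , Ψ₁ , sound₁) (Φ₂ , Ψ₂ , sound₂) = Φ₂ ∘ Φ₁ , (λ y → Ψ₂ y >>= Ψ₁) , sound
  where
  sound : ∀ x y → _solves_ C y (Φ₂ (Φ₁ x)) → ∃ λ s → (Ψ₂ y >>= Ψ₁) ≡ just s × _solves_ A s x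
  sound x y y-solves with t , Ψ₂y≡t , t-solves ← sound₂ (Φ₁ x) y y-solves
                     with s , Ψ₁t≡s , s-solves ← sound₁ x t t-solves
    = s , trans (cong (_>>= Ψ₁) Ψ₂y≡t) Ψ₁t≡s , s-solves

PHP-restrict : N ≤ M → PHP M n ≤ᴾ PHP N n
PHP-restrict {N} {M} N≤M =
    (λ f → f ∘ embed)
  , (λ { (i , j) → just (embed i , embed j) })
  , λ { f (i , j) (i<j , fi≡fj) →
          _ , refl , subst₂ ℕ._<_ (sym (toℕ-inject≤ i N≤M)) (sym (toℕ-inject≤ j N≤M)) i<j , fi≡fj }
  where
  embed : Fin N → Fin M
  embed i = inject≤ i N≤M

PairwiseSeparating : (I → P → Fin n) → Set
PairwiseSeparating F = ∀ a b → a ≢ b → Injective _≡_ _≡_ < F a , F b >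

separating-∘ʳ : {F : I → P → Fin n} {g : Q → P} →
                Injective _≡_ _≡_ g → PairwiseSeparating F → PairwiseSeparating (λ a → F a ∘ g)
separating-∘ʳ g-inj F-sep a b a≢b = g-inj ∘ F-sep a b a≢b

separating-pointwise : {F G : I → P → Fin n} →
                       (∀ a p → F a p ≡ G a p) → PairwiseSeparating F → PairwiseSeparating G
separating-pointwise {F = F} {G} F≗G F-sep a b a≢b {p} {q} eq = F-sep a b a≢b (begin
  (F a p , F b p)  ≡⟨ cong₂ _,_ (F≗G a p) (F≗G b p) ⟩
  (G a p , G b p)  ≡⟨ eq ⟩
  (G a q , G b q)  ≡⟨ cong₂ _,_ (F≗G a q) (F≗G b q) ⟨
  (F a q , F b q)  ∎)
  where open ≡-Reasoning

separating-↔ : P ↔ Q →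
               (∃[ F ] PairwiseSeparating {I} {P} {n} F) ⇔ (∃[ F ] PairwiseSeparating {I} {Q} {n} F)
separating-↔ P↔Q = mk⇔
  (λ (F , F-sep) → (λ a → F a ∘ from) , separating-∘ʳ (from-injective P↔Q) F-sep)
  (λ (F , F-sep) → (λ a → F a ∘ to) , separating-∘ʳ (to-injective P↔Q) F-sep)
  where open Inverse P↔Q using (to; from)

separating⇒≤ᴾ : {F : Fin m → Fin N → Fin n} → PairwiseSeparating F → idP m ≤ᴾ PHP N n
separating⇒≤ᴾ {m} {N} {n} {F} F-sep = F , Ψ , sound
  where
  Ψ : Fin N × Fin N → Maybe (Fin m)
  Ψ (p , q) with any? (λ a → F a p ≟ F a q)
  ... | yes (a , _) = just a
  ... | no  _       = nothing

  sound : ∀ x y → _solves_ (PHP N n) y (F x) → ∃ λ s → Ψ y ≡ just s × s ≡ x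
  sound x (p , q) (p<q , Fxp≡Fxq) with any? (λ a → F a p ≟ F a q)
  ... | no  none = contradiction (x , Fxp≡Fxq) none
  ... | yes (a , Fap≡Faq) with a ≟ x
  ...   | yes a≡x = a , refl , a≡x
  ...   | no  a≢x = contradiction (F-sep a x a≢x (cong₂ _,_ Fap≡Faq Fxp≡Fxq)) (<⇒≢ p<q)

sharedSolution⇒≡ : ((Φ , _) : idP m ≤ᴾ PHP N n) {a b : Fin m} {p q : Fin N} →
                   p Fin.< q → Φ a p ≡ Φ a q → Φ b p ≡ Φ b q → a ≡ b
sharedSolution⇒≡ (Φ , Ψ , sound) {a} {b} p<q Φap≡Φaq Φbp≡Φbq
  with s , Ψ≡s , refl ← sound a (_ , _) (p<q , Φap≡Φaq)
  with t , Ψ≡t , refl ← sound b (_ , _) (p<q , Φbp≡Φbq)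
  = just-injective (trans (sym Ψ≡s) Ψ≡t)

≤ᴾ⇒separating : (R : idP m ≤ᴾ PHP N n) → PairwiseSeparating (proj₁ R)
≤ᴾ⇒separating R a b a≢b {p} {q} eq with <-cmp p q
... | tri< p<q _ _ =
  contradiction (sharedSolution⇒≡ R p<q (,-injectiveˡ eq) (,-injectiveʳ eq)) a≢b
... | tri≈ _ p≡q _ = p≡q
... | tri> _ _ q<p =
  contradiction (sharedSolution⇒≡ R q<p (sym (,-injectiveˡ eq)) (sym (,-injectiveʳ eq))) a≢b

≤ᴾ-PHP⇔separating : idP m ≤ᴾ PHP N n ⇔ (∃[ F ] PairwiseSeparating {Fin m} {Fin N} {n} F)
≤ᴾ-PHP⇔separating = mk⇔ (λ R → proj₁ R , ≤ᴾ⇒separating R) (separating⇒≤ᴾ ∘ proj₂)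

Grid : ℕ → Set
Grid n = Fin n × Fin n

Grid↔Fin : Grid n ↔ Fin (n * n)
Grid↔Fin = ↔-sym *↔×

idP≤ᴾPHP⇒≤ : idP (2 + m) ≤ᴾ PHP N n → N ≤ n * n
idP≤ᴾPHP⇒≤ R = injective⇒≤ (≤ᴾ⇒separating R zero (suc zero) (λ ()) ∘ to-injective Grid↔Fin)

injective⇒isLatin : {L : Fin n → Fin n → Fin n} →
                    (∀ i → Injective _≡_ _≡_ (L i)) → (∀ j → Injective _≡_ _≡_ (λ i → L i j)) →
                    IsLatin n L
injective⇒isLatin rows-inj cols-inj =
    (λ i → injective⇒bijectiveᶠ ↔-refl (rows-inj i))
  , (λ j → injective⇒bijectiveᶠ ↔-refl (cols-inj j))

injective⇒orthogonal : {L M : Fin n → Fin n → Fin n} →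
                       Injective _≡_ _≡_ < uncurry L , uncurry M > → Orthogonal n L M
injective⇒orthogonal = injective⇒bijectiveᶠ Grid↔Fin

separates-swap : {f g : P → Fin n} → Injective _≡_ _≡_ < f , g > → Injective _≡_ _≡_ < g , f >
separates-swap fg-inj = fg-inj ∘ cong swap

module _ {L : Fin n → Fin n → Fin n} where

  rows⇒separates : (∀ i → Injective _≡_ _≡_ (L i)) → Injective _≡_ _≡_ < proj₁ , uncurry L >
  rows⇒separates rows-inj eq with refl , Lij≡Lij′ ← ,-injective eq =
    cong (_ ,_) (rows-inj _ Lij≡Lij′)

  cols⇒separates : (∀ j → Injective _≡_ _≡_ (λ i → L i j)) → Injective _≡_ _≡_ < proj₂ , uncurry L >
  cols⇒separates cols-inj eq with refl , Lij≡Li′j ← ,-injective eq =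
    cong (_, _) (cols-inj _ Lij≡Li′j)

  separates⇒rows : Injective _≡_ _≡_ < proj₁ , uncurry L > → ∀ i → Injective _≡_ _≡_ (L i)
  separates⇒rows sep i = ,-injectiveʳ ∘ sep ∘ cong (i ,_)

  separates⇒cols : Injective _≡_ _≡_ < proj₂ , uncurry L > → ∀ j → Injective _≡_ _≡_ (λ i → L i j)
  separates⇒cols sep j = ,-injectiveˡ ∘ sep ∘ cong (j ,_)

gridColouring : (Fin k → Fin n → Fin n → Fin n) → Fin (2 + k) → Grid n → Fin n
gridColouring L zero          = proj₁
gridColouring L (suc zero)    = proj₂
gridColouring L (suc (suc a)) = uncurry (L a)

module _ {L : Fin k → Fin n → Fin n → Fin n} where

  mols⇒separating : (∀ a → IsLatin n (L a)) → (∀ a b → a ≢ b → Orthogonal n (L a) (L b)) →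
                    PairwiseSeparating (gridColouring L)
  mols⇒separating lat orth zero          zero          0≢0 = contradiction refl 0≢0
  mols⇒separating lat orth zero          (suc zero)    _   = id
  mols⇒separating lat orth zero          (suc (suc b)) _   = rows⇒separates (proj₁ ∘ proj₁ (lat b))
  mols⇒separating lat orth (suc zero)    zero          _   = cong swap
  mols⇒separating lat orth (suc zero)    (suc zero)    1≢1 = contradiction refl 1≢1
  mols⇒separating lat orth (suc zero)    (suc (suc b)) _   = cols⇒separates (proj₁ ∘ proj₂ (lat b))
  mols⇒separating lat orth (suc (suc a)) zero          _   =
    separates-swap (rows⇒separates (proj₁ ∘ proj₁ (lat a)))
  mols⇒separating lat orth (suc (suc a)) (suc zero)    _   =
    separates-swap (cols⇒separates (proj₁ ∘ proj₂ (lat a)))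
  mols⇒separating lat orth (suc (suc a)) (suc (suc b)) a≢b =
    proj₁ (orth a b (a≢b ∘ cong (suc ∘ suc)))

  separating⇒mols : PairwiseSeparating (gridColouring L) → MOLS k n
  separating⇒mols sep = L , lat , orth
    where
    lat : ∀ a → IsLatin n (L a)
    lat a = injective⇒isLatin (separates⇒rows (sep zero (suc (suc a)) (λ ())))
                              (separates⇒cols (sep (suc zero) (suc (suc a)) (λ ())))
    orth : ∀ a b → a ≢ b → Orthogonal n (L a) (L b)
    orth a b a≢b =
      injective⇒orthogonal (sep (suc (suc a)) (suc (suc b)) (a≢b ∘ suc-injective ∘ suc-injective))

separating⇒gridColouring : {F : Fin (2 + k) → Grid n → Fin n} → PairwiseSeparating F →
                           ∃[ L ] PairwiseSeparating (gridColouring {k} {n} L)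
separating⇒gridColouring {k} {n} {F} F-sep =
  L , separating-pointwise F∘cell≗grid (separating-∘ʳ cell-injective F-sep)
  where
  coords : Grid n → Grid n
  coords = < F zero , F (suc zero) >

  coords-surjective : StrictlySurjective _≡_ coords
  coords-surjective = injective⇒strictlySurjectiveᶠ Grid↔Fin (F-sep zero (suc zero) (λ ()))

  cell : Grid n → Grid n
  cell = proj₁ ∘ coords-surjective

  coords-cell : ∀ c → coords (cell c) ≡ c
  coords-cell = proj₂ ∘ coords-surjective

  cell-injective : Injective _≡_ _≡_ cell
  cell-injective {c} {c′} eq = trans (sym (coords-cell c)) (trans (cong coords eq) (coords-cell c′))

  L : Fin k → Fin n → Fin n → Fin n
  L a i j = F (suc (suc a)) (cell (i , j))

  F∘cell≗grid : ∀ a c → F a (cell c) ≡ gridColouring L a c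
  F∘cell≗grid zero          c = ,-injectiveˡ (coords-cell c)
  F∘cell≗grid (suc zero)    c = ,-injectiveʳ (coords-cell c)
  F∘cell≗grid (suc (suc a)) c = refl

mols⇔separating : MOLS k n ⇔ (∃[ F ] PairwiseSeparating {Fin (2 + k)} {Grid n} {n} F)
mols⇔separating = mk⇔
  (λ (L , lat , orth) → gridColouring L , mols⇒separating lat orth)
  (λ (F , F-sep) → separating⇒mols (proj₂ (separating⇒gridColouring F-sep)))

mols⇔idP≤ᴾPHP : MOLS k n ⇔ idP (2 + k) ≤ᴾ PHP (n * n) n
mols⇔idP≤ᴾPHP =
  ⇔.trans mols⇔separating (⇔.trans (separating-↔ Grid↔Fin) (⇔.sym ≤ᴾ-PHP⇔separating))

%-cancelˡ-+ : ∀ o {m n d} .{{_ : NonZero d}} → (o + m) % d ≡ (o + n) % d → m % d ≡ n % d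
%-cancelˡ-+ o {m} {n} {d} eq =
  trans (viaShift m) (trans (cong (λ r → (r + (o * pred d) % d) % d) eq) (sym (viaShift n)))
  where
  open ≡-Reasoning
  viaShift : ∀ m → m % d ≡ ((o + m) % d + (o * pred d) % d) % d
  viaShift m = begin
    m % d                                ≡⟨ [m+kn]%n≡m%n m o d ⟨
    (m + o * d) % d                      ≡⟨ cong (λ x → (m + o * x) % d) (ℕ.suc-pred d) ⟨
    (m + o * ℕ.suc (pred d)) % d         ≡⟨ cong (λ x → (m + x) % d) (ℕ.*-suc o (pred d)) ⟩
    (m + (o + o * pred d)) % d           ≡⟨ cong (_% d) (ℕ.+-assoc m o _) ⟨
    (m + o + o * pred d) % d             ≡⟨ cong (λ x → (x + o * pred d) % d) (ℕ.+-comm m o) ⟩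
    (o + m + o * pred d) % d             ≡⟨ %-distribˡ-+ (o + m) (o * pred d) d ⟩
    ((o + m) % d + (o * pred d) % d) % d ∎

cyclicSquare : ∀ n .{{_ : NonZero n}} → Fin n → Fin n → Fin n
cyclicSquare n i j = (toℕ i + toℕ j) mod n

cyclicSquare-comm : ∀ n .{{_ : NonZero n}} i j → cyclicSquare n i j ≡ cyclicSquare n j i
cyclicSquare-comm n i j = cong (_mod n) (ℕ.+-comm (toℕ i) (toℕ j))

cyclicSquare-cancelˡ : ∀ n .{{_ : NonZero n}} i → Injective _≡_ _≡_ (cyclicSquare n i)
cyclicSquare-cancelˡ n i {j} {j′} eq = toℕ-injective (begin
  toℕ j       ≡⟨ m<n⇒m%n≡m (toℕ<n j) ⟨
  toℕ j % n   ≡⟨ %-cancelˡ-+ (toℕ i) sums≡ ⟩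
  toℕ j′ % n  ≡⟨ m<n⇒m%n≡m (toℕ<n j′) ⟩
  toℕ j′      ∎)
  where
  open ≡-Reasoning
  sums≡ : (toℕ i + toℕ j) % n ≡ (toℕ i + toℕ j′) % n
  sums≡ = trans (sym (toℕ-fromℕ< _)) (trans (cong toℕ eq) (toℕ-fromℕ< _))

cyclicSquare-cancelʳ : ∀ n .{{_ : NonZero n}} j → Injective _≡_ _≡_ (λ i → cyclicSquare n i j)
cyclicSquare-cancelʳ n j {i} {i′} eq =
  cyclicSquare-cancelˡ n j (trans (cyclicSquare-comm n j i) (trans eq (cyclicSquare-comm n i′ j)))

latinSquare : ∀ n → ∃ (IsLatin n)
latinSquare ℕ.zero    = (λ ()) , (λ ()) , (λ ())
latinSquare (ℕ.suc n) =
    cyclicSquare (ℕ.suc n)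
  , injective⇒isLatin (cyclicSquare-cancelˡ (ℕ.suc n)) (cyclicSquare-cancelʳ (ℕ.suc n))

mols₁ : ∀ n → MOLS 1 n
mols₁ n =
    (λ _ → proj₁ (latinSquare n))
  , (λ _ → proj₂ (latinSquare n))
  , λ { zero zero 0≢0 → contradiction refl 0≢0 }

idP₃≤ᴾPHP : ∀ n → idP 3 ≤ᴾ PHP (n * n) n
idP₃≤ᴾPHP n = Equivalence.to mols⇔idP≤ᴾPHP (mols₁ n)

theorem2p11 :
    (∀ (k n : ℕ) → 1 ≤ k → 2 ≤ n → MOLS k n ⇔ (idP (k + 2) ≤ᴾ PHP (n * n) n))
    × (∀ (n : ℕ) → 2 ≤ n → idP 3 ≤ᴾ PHP (n * n) n)
    × (∀ (n : ℕ) → 2 ≤ n →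
         (PHP (n * n + 1) n ≤ᴾ PHP (n * n) n) × ¬ (PHP (n * n) n ≤ᴾ PHP (n * n + 1) n))
theorem2p11 =
    (λ k n _ _ → subst (λ c → MOLS k n ⇔ idP c ≤ᴾ PHP (n * n) n) (ℕ.+-comm 2 k) mols⇔idP≤ᴾPHP)
  , (λ n _ → idP₃≤ᴾPHP n)
  , λ n _ → PHP-restrict (ℕ.m≤m+n (n * n) 1)
          , λ R → ℕ.m+1+n≰m (n * n)
                    (idP≤ᴾPHP⇒≤ (≤ᴾ-trans {C = PHP (n * n + 1) n} (idP₃≤ᴾPHP n) R))
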